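{- Let $H=C_a\square C_b$ be the toroidal grid with $a,b\geq 13$, let $n=ab$, and identify $V(H)$ with $[n]$. Then the set of all straight paths in $H$ with $5$ vertices is a resolving set for the Kneser graph $K(n,5)$. Therefore, for such $n$, $\beta(K(n,5))\leq 2n$.
   Context: The toroidal grid $C_a\square C_b$ has vertex set $\mathbb{Z}_a\times\mathbb{Z}_b$, with $(i,j)$ adjacent to $(i\pm1,j)$ and $(i,j\pm1)$. A straight path with $m$ vertices is a vertex set of the form $\{(i,j),(i+1,j),\dots,(i+m-1,j)\}$ or $\{(i,j),(i,j+1),\dots,(i,j+m-1)\}$ (so there are $2ab$ of them for each fixed $m$ smaller than $a,b$). The Kneser graph $K(n,k)$ has as vertices the $k$-subsets of $[n]$, adjacent when disjoint. A resolving set is a set $\mathcal{S}$ of vertices such that for all distinct vertices $U,W$ some $X\in\mathcal{S}$ has $d(U,X)\neq d(W,X)$; $\beta$ is the minimum size of a resolving set. -}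

module Defs where

open import Data.Nat using (ℕ; zero; suc; _+_; _*_; _<_; NonZero)
open import Data.Nat.DivMod using (_mod_)
open import Data.Fin using (Fin; toℕ; combine)
open import Data.Fin.Subset using (Subset; ∣_∣; _∩_; _∪_; ⁅_⁆; Empty)
open import Data.Product using (Σ; ∃; _×_)
open import Data.Sum using (_⊎_)
open import Relation.Binary.PropositionalEquality using (_≡_; _≢_)
open import Relation.Nullary using (¬_)

-- Kneser graph K(n,k): vertices are subsets p of [n] = Fin n with ∣ p ∣ ≡ k,
-- adjacent iff disjoint.

Disjoint : ∀ {n} → Subset n → Subset n → Set
Disjoint p q = Empty (p ∩ q)

-- Walks in K(n,k) of length m from p to r (every vertex visited is a k-subset
-- once the start is).
data KWalk {n : ℕ} (k : ℕ) : Subset n → Subset n → ℕ → Set where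
  here : ∀ {p} → KWalk k p p 0
  step : ∀ {p q r m} → Disjoint p q → ∣ q ∣ ≡ k → KWalk k q r m →
         KWalk k p r (suc m)

KDist : ∀ {n} (k : ℕ) → Subset n → Subset n → ℕ → Set
KDist k p r m = KWalk k p r m × (∀ m' → m' < m → ¬ KWalk k p r m')

IsResolving : ∀ {n} (k : ℕ) → (Subset n → Set) → Set
IsResolving {n} k S =
  (∀ X → S X → ∣ X ∣ ≡ k) ×
  (∀ (U W : Subset n) → ∣ U ∣ ≡ k → ∣ W ∣ ≡ k → U ≢ W →
     ∃ λ X → S X × ∃ λ m → KDist k U X m × ¬ KDist k W X m)

-- Toroidal grid C_a □ C_b, vertex (i , j) identified with combine i j : Fin (a * b).

vtx : ∀ {a b} → Fin a → Fin b → Fin (a * b)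
vtx i j = combine i j

_⊕_ : ∀ {a} .{{_ : NonZero a}} → Fin a → ℕ → Fin a
_⊕_ {a} i t = (toℕ i + t) mod a

hpath : ∀ {a b} .{{_ : NonZero a}} → Fin a → Fin b → Subset (a * b)
hpath i j = ⁅ vtx (i ⊕ 0) j ⁆ ∪ ⁅ vtx (i ⊕ 1) j ⁆ ∪ ⁅ vtx (i ⊕ 2) j ⁆
          ∪ ⁅ vtx (i ⊕ 3) j ⁆ ∪ ⁅ vtx (i ⊕ 4) j ⁆

vpath : ∀ {a b} .{{_ : NonZero b}} → Fin a → Fin b → Subset (a * b)
vpath i j = ⁅ vtx i (j ⊕ 0) ⁆ ∪ ⁅ vtx i (j ⊕ 1) ⁆ ∪ ⁅ vtx i (j ⊕ 2) ⁆
          ∪ ⁅ vtx i (j ⊕ 3) ⁆ ∪ ⁅ vtx i (j ⊕ 4) ⁆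

StraightPath5 : ∀ a b .{{_ : NonZero a}} .{{_ : NonZero b}} → Subset (a * b) → Set
StraightPath5 a b X = ∃ λ (i : Fin a) → ∃ λ (j : Fin b) → X ≡ hpath i j ⊎ X ≡ vpath i j

module Submission where

-- Distances in K(n, k) for n ≥ 3k take only the values 0, 1, 2, so a vertex X
-- distinguishes U from W as soon as X is disjoint from one of them and meets the
-- other; we say that X separates U and W.  The heart of the proof is therefore the
-- combinatorial claim that any two distinct 5-sets U, W of grid points are separated
-- by a straight path.  Scanning the row and the column through a point z ∈ W ∖ U
-- (cycles of length ≥ 9) either produces a separating path through z, or shows that
-- U has a "cross" at z: two points in the row of z and two in its column.  A purely
-- combinatorial case analysis (valid for any two relations A → B → Set with at most
-- five points each) shows that crosses cannot occur everywhere they would be forced.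

open import Defs
open import Data.Nat using (ℕ; zero; suc; _+_; _*_; _∸_; _≤_; _<_; z≤n; s≤s; NonZero)
open import Data.Nat.Properties
open import Data.Nat.DivMod using (_%_; m<n⇒m%n≡m; [m+n]%n≡m%n; %-distribˡ-+; m%n%n≡m%n)
open import Data.Fin using (Fin; toℕ; fromℕ)
open import Data.Fin.Properties using (toℕ-injective; toℕ-fromℕ<; toℕ<n; toℕ≤n; any?; combine-injective; combine-surjective)
  renaming (_≟_ to _≟ᶠ_)
open import Data.Fin.Subset using (Subset)
open import Data.Bool using (true; false)
import Data.Bool as Bool
open import Data.Vec.Properties using (≡-dec)
open import Data.Vec using ([]; _∷_)
open import Data.List using (List; []; _∷_; length; map; tabulate; _++_; cartesianProductWith; allFin)
open import Data.List.Properties using (length-map; length-++; length-tabulate)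
open import Data.List.Relation.Unary.All using (All; []; _∷_)
import Data.List.Relation.Unary.All as All
import Data.List.Relation.Unary.All.Properties as All
open import Data.List.Relation.Unary.AllPairs using ([]; _∷_)
import Data.List.Relation.Unary.AllPairs as AllPairs
import Data.List.Relation.Unary.AllPairs.Properties as AllPairs
open import Data.List.Relation.Unary.Unique.Propositional using (Unique)
import Data.List.Relation.Unary.Unique.Propositional.Properties as Unique
open import Data.Product using (∃; ∃₂; _×_; _,_; proj₁; proj₂; swap; uncurry)
open import Data.Product.Properties using (,-injectiveˡ; ,-injectiveʳ)
open import Data.Sum using (_⊎_; inj₁; inj₂)
import Data.Sum as Sum
open import Data.Empty using (⊥-elim)
open import Function using (_∘_; flip)
open import Relation.Nullary using (¬_; Dec; yes; no)
open import Relation.Nullary.Decidable using (_×-dec_; ¬?)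
open import Relation.Binary.Definitions using (DecidableEquality; tri<; tri≈; tri>)
open import Relation.Binary.PropositionalEquality

module Resolving where

  open import Data.Fin.Subset
  open import Data.Fin.Subset.Properties

  size-suc⇒nonempty : ∀ {n k} (p : Subset n) → ∣ p ∣ ≡ suc k → Nonempty p
  size-suc⇒nonempty {n} p ∣p∣≡1+k with nonempty? p
  ... | yes ne = ne
  ... | no empty = ⊥-elim (0≢1+n (trans (sym (∣⊥∣≡0 n)) (trans (cong ∣_∣ (sym (Empty-unique empty))) ∣p∣≡1+k)))

  unique⊆⇒length≤ : ∀ {n} (p : Subset n) (xs : List (Fin n)) → Unique xs → All (_∈ p) xs → length xs ≤ ∣ p ∣
  unique⊆⇒length≤ p []       _                _            = z≤n
  unique⊆⇒length≤ p (x ∷ xs) (x∉xs ∷ unique) (x∈p ∷ xs⊆p) = begin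
    suc (length xs) ≤⟨ s≤s (unique⊆⇒length≤ (p - x) xs unique xs⊆p-x) ⟩
    suc ∣ p - x ∣   ≤⟨ x∈p⇒∣p-x∣<∣p∣ x∈p ⟩
    ∣ p ∣           ∎
    where
    open ≤-Reasoning
    xs⊆p-x : All (_∈ p - x) xs
    xs⊆p-x = All.zipWith (λ (y∈p , x≢y) → x∈p∧x≢y⇒x∈p-y y∈p (x≢y ∘ sym)) (xs⊆p , x∉xs)

  ∣p∪q∣≤∣p∣+∣q∣ : ∀ {n} (p q : Subset n) → ∣ p ∪ q ∣ ≤ ∣ p ∣ + ∣ q ∣
  ∣p∪q∣≤∣p∣+∣q∣ []          []          = z≤n
  ∣p∪q∣≤∣p∣+∣q∣ (true ∷ p)  (true ∷ q)  = s≤s (≤-trans (∣p∪q∣≤∣p∣+∣q∣ p q) (≤-trans (n≤1+n _) (≤-reflexive (sym (+-suc _ _)))))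
  ∣p∪q∣≤∣p∣+∣q∣ (true ∷ p)  (false ∷ q) = s≤s (∣p∪q∣≤∣p∣+∣q∣ p q)
  ∣p∪q∣≤∣p∣+∣q∣ (false ∷ p) (true ∷ q)  = ≤-trans (s≤s (∣p∪q∣≤∣p∣+∣q∣ p q)) (≤-reflexive (sym (+-suc _ _)))
  ∣p∪q∣≤∣p∣+∣q∣ (false ∷ p) (false ∷ q) = ∣p∪q∣≤∣p∣+∣q∣ p q

  subsetOfSize : ∀ {n} (p : Subset n) k → k ≤ ∣ p ∣ → ∃ λ q → q ⊆ p × ∣ q ∣ ≡ k
  subsetOfSize {n} p zero _ = ⊥ , (⊥-elim ∘ ∉⊥) , ∣⊥∣≡0 n
  subsetOfSize (true ∷ p) (suc k) (s≤s k≤∣p∣) with subsetOfSize p k k≤∣p∣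
  ... | q , q⊆p , ∣q∣≡k = true ∷ q , s⊆s q⊆p , cong suc ∣q∣≡k
  subsetOfSize (false ∷ p) (suc k) k<∣p∣ with subsetOfSize p (suc k) k<∣p∣
  ... | q , q⊆p , ∣q∣≡k = false ∷ q , s⊆s q⊆p , ∣q∣≡k

  ⊈⇒witness : ∀ {n} (p q : Subset n) → ¬ p ⊆ q → ∃ λ z → z ∈ p × z ∉ q
  ⊈⇒witness p q p⊈q with any? (λ z → (z ∈? p) ×-dec ¬? (z ∈? q))
  ... | yes witness = witness
  ... | no none = ⊥-elim (p⊈q p⊆q)
    where
    p⊆q : p ⊆ q
    p⊆q {z} z∈p with z ∈? q
    ... | yes z∈q = z∈q
    ... | no z∉q = ⊥-elim (none (z , z∈p , z∉q))

  ∃-∈-∉ : ∀ {n} (U W : Subset n) → ∣ U ∣ ≡ ∣ W ∣ → U ≢ W → ∃ λ z → z ∈ W × z ∉ U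
  ∃-∈-∉ U W ∣U∣≡∣W∣ U≢W with W ⊆? U
  ... | no W⊈U = ⊈⇒witness W U W⊈U
  ... | yes W⊆U with U ⊆? W
  ...   | yes U⊆W = ⊥-elim (U≢W (⊆-antisym U⊆W W⊆U))
  ...   | no U⊈W = ⊥-elim (<-irrefl (sym ∣U∣≡∣W∣) (p⊂q⇒∣p∣<∣q∣ (W⊆U , ⊈⇒witness U W U⊈W)))

  -- Distances in the Kneser graph K(n, k): uniqueness, and the values 0, 1, 2.

  module _ {n k : ℕ} where

    walk0 : ∀ {p r : Subset n} → KWalk k p r 0 → p ≡ r
    walk0 here = refl

    walk1 : ∀ {p r : Subset n} → KWalk k p r 1 → Disjoint p r
    walk1 (step p∩q=∅ _ here) = p∩q=∅

    KDist-unique : ∀ {p r : Subset n} {m m'} → KDist k p r m → KDist k p r m' → m ≡ m'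
    KDist-unique {m = m} {m'} (w , minimal) (w' , minimal') with <-cmp m m'
    ... | tri< m<m' _ _ = ⊥-elim (minimal' m m<m' w)
    ... | tri≈ _ m≡m' _ = m≡m'
    ... | tri> _ _ m>m' = ⊥-elim (minimal m' m>m' w')

    complementLarge : 3 * k ≤ n → ∀ (U X : Subset n) → ∣ U ∣ ≡ k → ∣ X ∣ ≡ k → k ≤ ∣ ∁ (U ∪ X) ∣
    complementLarge 3k≤n U X ∣U∣ ∣X∣ = begin
      k                 ≤⟨ m+n≤o⇒m≤o∸n k 3k≤n ⟩
      n ∸ (k + (k + 0)) ≤⟨ ∸-monoʳ-≤ n (≤-trans (∣p∪q∣≤∣p∣+∣q∣ U X) (≤-reflexive (cong₂ _+_ ∣U∣ (trans ∣X∣ (sym (+-identityʳ k)))))) ⟩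
      n ∸ ∣ U ∪ X ∣     ≡⟨ ∣∁p∣≡n∸∣p∣ (U ∪ X) ⟨
      ∣ ∁ (U ∪ X) ∣     ∎
      where open ≤-Reasoning

    commonNeighbour : 3 * k ≤ n → ∀ (U X : Subset n) → ∣ U ∣ ≡ k → ∣ X ∣ ≡ k →
                      ∃ λ Y → ∣ Y ∣ ≡ k × Disjoint U Y × Disjoint Y X
    commonNeighbour 3k≤n U X ∣U∣ ∣X∣
      with Y , Y⊆∁U∪X , ∣Y∣ ← subsetOfSize (∁ (U ∪ X)) k (complementLarge 3k≤n U X ∣U∣ ∣X∣) =
      Y , ∣Y∣ , U∩Y=∅ , Y∩X=∅
      where
      U∩Y=∅ : Disjoint U Y
      U∩Y=∅ (z , z∈U∩Y) with z∈U , z∈Y ← x∈p∩q⁻ U Y z∈U∩Y = x∈∁p⇒x∉p (Y⊆∁U∪X z∈Y) (x∈p∪q⁺ (inj₁ z∈U))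
      Y∩X=∅ : Disjoint Y X
      Y∩X=∅ (z , z∈Y∩X) with z∈Y , z∈X ← x∈p∩q⁻ Y X z∈Y∩X = x∈∁p⇒x∉p (Y⊆∁U∪X z∈Y) (x∈p∪q⁺ (inj₂ z∈X))

    meet⇒dist : 3 * k ≤ n → ∀ (U X : Subset n) → ∣ U ∣ ≡ k → ∣ X ∣ ≡ k → Nonempty (U ∩ X) →
                ∃ λ m → KDist k U X m × m ≢ 1
    meet⇒dist 3k≤n U X ∣U∣ ∣X∣ U∩X≠∅ with ≡-dec Bool._≟_ U X
    ... | yes refl = 0 , (here , λ _ ()) , λ ()
    ... | no U≢X with Y , ∣Y∣ , U∩Y=∅ , Y∩X=∅ ← commonNeighbour 3k≤n U X ∣U∣ ∣X∣ =
      2 , (step U∩Y=∅ ∣Y∣ (step Y∩X=∅ ∣X∣ here) , shorter) , λ ()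
      where
      shorter : ∀ m → m < 2 → ¬ KWalk k U X m
      shorter zero _ w = U≢X (walk0 w)
      shorter (suc zero) _ w = walk1 w U∩X≠∅
      shorter (suc (suc _)) (s≤s (s≤s ()))

  disjoint⇒dist1 : ∀ {n k} {U X : Subset n} → ∣ U ∣ ≡ suc k → ∣ X ∣ ≡ suc k → Disjoint U X → KDist (suc k) U X 1
  disjoint⇒dist1 {k = k} {U} {X} ∣U∣ ∣X∣ U∩X=∅ = step U∩X=∅ ∣X∣ here , shorter
    where
    shorter : ∀ m → m < 1 → ¬ KWalk (suc k) U X m
    shorter (suc _) (s≤s ())
    shorter zero _ w with z , z∈U ← size-suc⇒nonempty U ∣U∣ =
      U∩X=∅ (z , x∈p∩q⁺ (z∈U , subst (z ∈_) (walk0 w) z∈U))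

  Separates : ∀ {n} → Subset n → Subset n → Subset n → Set
  Separates X U W = (Disjoint U X × Nonempty (W ∩ X)) ⊎ (Disjoint W X × Nonempty (U ∩ X))

  separates⇒resolves : ∀ {n k} → 3 * suc k ≤ n → ∀ {U W X : Subset n} →
    ∣ U ∣ ≡ suc k → ∣ W ∣ ≡ suc k → ∣ X ∣ ≡ suc k → Separates X U W →
    ∃ λ m → KDist (suc k) U X m × ¬ KDist (suc k) W X m
  separates⇒resolves _ ∣U∣ ∣W∣ ∣X∣ (inj₁ (U∩X=∅ , W∩X≠∅)) =
    1 , disjoint⇒dist1 ∣U∣ ∣X∣ U∩X=∅ , λ (w , _) → walk1 w W∩X≠∅
  separates⇒resolves 3k≤n {U} {W} {X} ∣U∣ ∣W∣ ∣X∣ (inj₂ (W∩X=∅ , U∩X≠∅))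
    with m , dist , m≢1 ← meet⇒dist 3k≤n U X ∣U∣ ∣X∣ U∩X≠∅ =
    m , dist , λ dist' → m≢1 (KDist-unique dist' (disjoint⇒dist1 ∣W∣ ∣X∣ W∩X=∅))

  module _ {m : ℕ} .{{_ : NonZero m}} where

    toℕ-⊕ : ∀ (i : Fin m) t → toℕ (i ⊕ t) ≡ (toℕ i + t) % m
    toℕ-⊕ i t = toℕ-fromℕ< _

    ⊕-assoc : ∀ (i : Fin m) s t → (i ⊕ s) ⊕ t ≡ i ⊕ (s + t)
    ⊕-assoc i s t = toℕ-injective (begin
      toℕ ((i ⊕ s) ⊕ t)         ≡⟨ toℕ-⊕ (i ⊕ s) t ⟩
      (toℕ (i ⊕ s) + t) % m     ≡⟨ cong (λ r → (r + t) % m) (toℕ-⊕ i s) ⟩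
      ((toℕ i + s) % m + t) % m ≡⟨ %-distribˡ-+ ((toℕ i + s) % m) t m ⟩
      ((toℕ i + s) % m % m + t % m) % m ≡⟨ cong (λ r → (r + t % m) % m) (m%n%n≡m%n (toℕ i + s) m) ⟩
      ((toℕ i + s) % m + t % m) % m ≡⟨ %-distribˡ-+ (toℕ i + s) t m ⟨
      (toℕ i + s + t) % m       ≡⟨ cong (_% m) (+-assoc (toℕ i) s t) ⟩
      (toℕ i + (s + t)) % m     ≡⟨ toℕ-⊕ i (s + t) ⟨
      toℕ (i ⊕ (s + t))         ∎)
      where open ≡-Reasoning

    ⊕-period : ∀ (i : Fin m) → i ⊕ m ≡ i
    ⊕-period i = toℕ-injective (begin
      toℕ (i ⊕ m)     ≡⟨ toℕ-⊕ i m ⟩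
      (toℕ i + m) % m ≡⟨ [m+n]%n≡m%n (toℕ i) m ⟩
      toℕ i % m       ≡⟨ m<n⇒m%n≡m (toℕ<n i) ⟩
      toℕ i           ∎)
      where open ≡-Reasoning

    ⊕-identityʳ : ∀ (i : Fin m) → i ⊕ 0 ≡ i
    ⊕-identityʳ i = toℕ-injective (trans (toℕ-⊕ i 0) (trans (cong (_% m) (+-identityʳ (toℕ i))) (m<n⇒m%n≡m (toℕ<n i))))

    ⊕-back-forth : ∀ (i : Fin m) {t} → t ≤ m → i ⊕ (m ∸ t + t) ≡ i
    ⊕-back-forth i t≤m = trans (cong (i ⊕_) (m∸n+n≡m t≤m)) (⊕-period i)

    unshift : ∀ (i : Fin m) s → s < m → toℕ ((i ⊕ s) ⊕ (m ∸ toℕ i)) ≡ s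
    unshift i s s<m = begin
      toℕ ((i ⊕ s) ⊕ (m ∸ toℕ i))       ≡⟨ cong toℕ (⊕-assoc i s (m ∸ toℕ i)) ⟩
      toℕ (i ⊕ (s + (m ∸ toℕ i)))       ≡⟨ toℕ-⊕ i (s + (m ∸ toℕ i)) ⟩
      (toℕ i + (s + (m ∸ toℕ i))) % m   ≡⟨ cong (_% m) (+-comm (toℕ i) _) ⟩
      (s + (m ∸ toℕ i) + toℕ i) % m     ≡⟨ cong (_% m) (+-assoc s (m ∸ toℕ i) (toℕ i)) ⟩
      (s + (m ∸ toℕ i + toℕ i)) % m     ≡⟨ cong (λ r → (s + r) % m) (m∸n+n≡m (toℕ≤n i)) ⟩
      (s + m) % m                       ≡⟨ [m+n]%n≡m%n s m ⟩
      s % m                             ≡⟨ m<n⇒m%n≡m s<m ⟩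
      s                                 ∎
      where open ≡-Reasoning

    ⊕-injective : ∀ (i : Fin m) {s t} → s < m → t < m → i ⊕ s ≡ i ⊕ t → s ≡ t
    ⊕-injective i {s} {t} s<m t<m eq = begin
      s                           ≡⟨ unshift i s s<m ⟨
      toℕ ((i ⊕ s) ⊕ (m ∸ toℕ i)) ≡⟨ cong (λ j → toℕ (j ⊕ (m ∸ toℕ i))) eq ⟩
      toℕ ((i ⊕ t) ⊕ (m ∸ toℕ i)) ≡⟨ unshift i t t<m ⟩
      t                           ∎
      where open ≡-Reasoning

    -- On a cycle of length at least 9 the windows c, …, c+4 and c−4, …, c
    -- meet only in c.
    windows-meet-at-c : 9 ≤ m → ∀ (c : Fin m) {s t} → s ≤ 4 → t ≤ 4 →
                        c ⊕ s ≡ c ⊕ (m ∸ 4 + t) → c ⊕ s ≡ c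
    windows-meet-at-c 9≤m c {s} {t} s≤4 t≤4 eq with m≤n⇒m<n∨m≡n t≤4
    ... | inj₂ refl = trans eq (⊕-back-forth c (≤-trans (m≤n+m 4 5) 9≤m))
    ... | inj₁ t<4 = ⊥-elim (<⇒≢ s<back (⊕-injective c s<m back<m eq))
      where
      back<m : m ∸ 4 + t < m
      back<m = ≤-trans (+-monoʳ-< (m ∸ 4) t<4) (≤-reflexive (m∸n+n≡m (≤-trans (m≤n+m 4 5) 9≤m)))
      s<back : s < m ∸ 4 + t
      s<back = ≤-trans (s≤s s≤4) (≤-trans (m+n≤o⇒m≤o∸n 5 9≤m) (m≤m+n (m ∸ 4) t))
      s<m : s < m
      s<m = <-trans s<back back<m

  five : ∀ {n} → (ℕ → Fin n) → Subset n
  five f = ⁅ f 0 ⁆ ∪ ⁅ f 1 ⁆ ∪ ⁅ f 2 ⁆ ∪ ⁅ f 3 ⁆ ∪ ⁅ f 4 ⁆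

  module _ {n : ℕ} {x : Fin n} {p : Subset n} where

    ∈-head : x ∈ ⁅ x ⁆ ∪ p
    ∈-head = x∈p∪q⁺ (inj₁ (x∈⁅x⁆ x))

    ∈-tail : ∀ {z} → z ∈ p → z ∈ ⁅ x ⁆ ∪ p
    ∈-tail z∈p = x∈p∪q⁺ (inj₂ z∈p)

    ∈-cons⁻ : ∀ {z} → z ∈ ⁅ x ⁆ ∪ p → z ≡ x ⊎ z ∈ p
    ∈-cons⁻ z∈ = Sum.map₁ (x∈⁅y⁆⇒x≡y x) (x∈p∪q⁻ ⁅ x ⁆ p z∈)

  module _ {n : ℕ} (f : ℕ → Fin n) where

    ∈-five : ∀ (t : Fin 5) → f (toℕ t) ∈ five f
    ∈-five Fin.zero                                         = ∈-head
    ∈-five (Fin.suc Fin.zero)                               = ∈-tail ∈-head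
    ∈-five (Fin.suc (Fin.suc Fin.zero))                     = ∈-tail (∈-tail ∈-head)
    ∈-five (Fin.suc (Fin.suc (Fin.suc Fin.zero)))           = ∈-tail (∈-tail (∈-tail ∈-head))
    ∈-five (Fin.suc (Fin.suc (Fin.suc (Fin.suc Fin.zero)))) = ∈-tail (∈-tail (∈-tail (∈-tail (x∈⁅x⁆ (f 4)))))

    five-∈ : ∀ {z} → z ∈ five f → ∃ λ (t : Fin 5) → z ≡ f (toℕ t)
    five-∈ z∈ with ∈-cons⁻ z∈
    ... | inj₁ z≡f0 = Fin.zero , z≡f0
    ... | inj₂ z∈ with ∈-cons⁻ z∈
    ... | inj₁ z≡f1 = Fin.suc Fin.zero , z≡f1
    ... | inj₂ z∈ with ∈-cons⁻ z∈
    ... | inj₁ z≡f2 = Fin.suc (Fin.suc Fin.zero) , z≡f2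
    ... | inj₂ z∈ with ∈-cons⁻ z∈
    ... | inj₁ z≡f3 = Fin.suc (Fin.suc (Fin.suc Fin.zero)) , z≡f3
    ... | inj₂ z∈f4 = Fin.suc (Fin.suc (Fin.suc (Fin.suc Fin.zero))) , x∈⁅y⁆⇒x≡y (f 4) z∈f4

    five-disjoint : ∀ (V : Subset n) → ¬ (∃ λ (t : Fin 5) → f (toℕ t) ∈ V) → Disjoint V (five f)
    five-disjoint V miss (z , z∈V∩five) with z∈V , z∈five ← x∈p∩q⁻ V (five f) z∈V∩five
      with t , refl ← five-∈ z∈five = miss (t , z∈V)

    five-size : (∀ {s t : Fin 5} → f (toℕ s) ≡ f (toℕ t) → s ≡ t) → ∣ five f ∣ ≡ 5
    five-size injective = ≤-antisym atMost5 atLeast5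
      where
      add1 : ∀ (x : Fin n) (p : Subset n) {k} → ∣ p ∣ ≤ k → ∣ ⁅ x ⁆ ∪ p ∣ ≤ suc k
      add1 x p ∣p∣≤k = ≤-trans (∣p∪q∣≤∣p∣+∣q∣ ⁅ x ⁆ p) (≤-trans (≤-reflexive (cong (_+ ∣ p ∣) (∣⁅x⁆∣≡1 x))) (s≤s ∣p∣≤k))
      atMost5 : ∣ five f ∣ ≤ 5
      atMost5 = add1 (f 0) _ (add1 (f 1) _ (add1 (f 2) _ (add1 (f 3) _ (≤-reflexive (∣⁅x⁆∣≡1 (f 4))))))
      atLeast5 : 5 ≤ ∣ five f ∣
      atLeast5 = unique⊆⇒length≤ (five f) (tabulate (f ∘ toℕ)) (Unique.tabulate⁺ injective) (All.tabulate⁺ ∈-five)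

  -- Straight lines on a cycle of length at least 9.

  Two : ∀ {C : Set} → (C → Set) → Set
  Two {C} P = ∃₂ λ (c₁ c₂ : C) → c₁ ≢ c₂ × P c₁ × P c₂

  -- A cycle ℤ_m embedded into Fin n by g (a row or a column of the torus).
  module Line {n m : ℕ} .{{_ : NonZero m}} (9≤m : 9 ≤ m) (g : Fin m → Fin n) where

    point : Fin m → ℕ → Fin n
    point c t = g (c ⊕ t)

    line : Fin m → Subset n
    line c = five (point c)

    line-size : (∀ {c c'} → g c ≡ g c' → c ≡ c') → ∀ c → ∣ line c ∣ ≡ 5
    line-size g-injective c = five-size (point c) λ {s} {t} eq →
      toℕ-injective (⊕-injective c (below-m s) (below-m t) (g-injective eq))
      where
      below-m : ∀ (t : Fin 5) → toℕ t < m
      below-m t = ≤-trans (toℕ<n t) (≤-trans (m≤m+n 5 4) 9≤m)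

    behind : Fin m → Fin m
    behind c = c ⊕ (m ∸ 4)

    ∈-line-ahead : ∀ c → g c ∈ line c
    ∈-line-ahead c = subst (λ c' → g c' ∈ line c) (⊕-identityʳ c) (∈-five (point c) Fin.zero)

    ∈-line-behind : ∀ c → g c ∈ line (behind c)
    ∈-line-behind c = subst (λ c' → g c' ∈ line (behind c)) behind⊕4 (∈-five (point (behind c)) (fromℕ 4))
      where
      behind⊕4 : behind c ⊕ 4 ≡ c
      behind⊕4 = trans (⊕-assoc c (m ∸ 4) 4) (⊕-back-forth c (≤-trans (m≤n+m 4 5) 9≤m))

    scan : ∀ (V : Subset n) c → g c ∉ V →
           (∃ λ c₀ → g c ∈ line c₀ × Disjoint V (line c₀)) ⊎ Two (λ c' → g c' ∈ V)
    scan V c gc∉V with any? (λ t → point c (toℕ t) ∈? V) | any? (λ t → point (behind c) (toℕ t) ∈? V)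
    ... | no miss | _     = inj₁ (c , ∈-line-ahead c , five-disjoint (point c) V miss)
    ... | yes _   | no miss = inj₁ (behind c , ∈-line-behind c , five-disjoint (point (behind c)) V miss)
    ... | yes (t , ahead∈V) | yes (t' , behind∈V) =
      inj₂ (c ⊕ toℕ t , behind c ⊕ toℕ t' , apart , ahead∈V , behind∈V)
      where
      -- The two points could only coincide at c itself, which is not in V.
      apart : c ⊕ toℕ t ≢ behind c ⊕ toℕ t'
      apart eq = gc∉V (subst (λ c' → g c' ∈ V)
        (windows-meet-at-c 9≤m c (≤-pred (toℕ<n t)) (≤-pred (toℕ<n t')) (trans eq (⊕-assoc c (m ∸ 4) (toℕ t'))))
        ahead∈V)

  two-avoid : ∀ {C : Set} → DecidableEquality C → ∀ {P : C → Set} → Two P → (z : C) → ∃ λ c → P c × c ≢ z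
  two-avoid _≟_ (c₁ , c₂ , c₁≢c₂ , p₁ , p₂) z with c₁ ≟ z
  ... | yes refl = c₂ , p₂ , c₁≢c₂ ∘ sym
  ... | no c₁≢z = c₁ , p₁ , c₁≢z

  module _ {A B : Set} where

    -- Relations V : A → B → Set are read as sets of grid points.
    -- V has a cross at (x, y): two points in the row of y and two in the column of x.
    Cross : (A → B → Set) → A → B → Set
    Cross V x y = Two (λ x' → V x' y) × Two (λ y' → V x y')

    Few : (A → B → Set) → Set
    Few V = ∀ (ps : List (A × B)) → Unique ps → All (uncurry V) ps → length ps ≤ 5

    rowApart : ∀ (V : A → B → Set) {x x' y} → V x' y → ¬ V x y → x' ≢ x
    rowApart _ v ¬v refl = ¬v v

    colApart : ∀ (V : A → B → Set) {x y y'} → V x y' → ¬ V x y → y' ≢ y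
    colApart _ v ¬v refl = ¬v v

    apartˣ : ∀ {x x' : A} {y y' : B} → x ≢ x' → (x , y) ≢ (x' , y')
    apartˣ x≢x' = x≢x' ∘ ,-injectiveˡ

    apartʸ : ∀ {x x' : A} {y y' : B} → y ≢ y' → (x , y) ≢ (x' , y')
    apartʸ y≢y' = y≢y' ∘ ,-injectiveʳ

    module _ {V : A → B → Set} {x : A} {y : B} where

      arms : Cross V x y → List (A × B)
      arms ((xl , xr , _) , (yd , yu , _)) = (xl , y) ∷ (xr , y) ∷ (x , yd) ∷ (x , yu) ∷ []

      arms-∈ : ∀ (c : Cross V x y) → All (uncurry V) (arms c)
      arms-∈ ((_ , _ , _ , vl , vr) , (_ , _ , _ , vd , vu)) = vl ∷ vr ∷ vd ∷ vu ∷ []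

      arms-unique : ¬ V x y → ∀ (c : Cross V x y) → Unique (arms c)
      arms-unique ¬v ((_ , _ , l≢r , vl , vr) , (_ , _ , d≢u , _ , _)) =
        (apartˣ l≢r ∷ apartˣ (rowApart V vl ¬v) ∷ apartˣ (rowApart V vl ¬v) ∷ [])
        ∷ (apartˣ (rowApart V vr ¬v) ∷ apartˣ (rowApart V vr ¬v) ∷ [])
        ∷ (apartʸ d≢u ∷ []) ∷ [] ∷ []

      centre-fresh : ¬ V x y → ∀ (c : Cross V x y) → All ((x , y) ≢_) (arms c)
      centre-fresh ¬v ((_ , _ , _ , vl , vr) , (_ , _ , _ , vd , vu)) =
        apartˣ (rowApart V vl ¬v ∘ sym) ∷ apartˣ (rowApart V vr ¬v ∘ sym)
        ∷ apartʸ (colApart V vd ¬v ∘ sym) ∷ apartʸ (colApart V vu ¬v ∘ sym) ∷ []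

      offAxis-fresh : ∀ {ex ey} → ex ≢ x → ey ≢ y → ∀ (c : Cross V x y) → All ((ex , ey) ≢_) (arms c)
      offAxis-fresh ex≢x ey≢y _ = apartʸ ey≢y ∷ apartʸ ey≢y ∷ apartˣ ex≢x ∷ apartˣ ex≢x ∷ []

    six-points : ∀ {V} → Few V → ∀ {ps} → Unique ps → All (uncurry V) ps → length ps ≢ 6
    six-points few unique ps∈V six = <-irrefl refl (subst (_≤ 5) six (few _ unique ps∈V))

  transpose : ∀ {A B} {V : A → B → Set} {x y} → Cross V x y → Cross (flip V) y x
  transpose = swap

  Few-transpose : ∀ {A B} {V : A → B → Set} → Few V → Few (flip V)
  Few-transpose few ps unique ps∈V = begin
    length ps            ≡⟨ length-map swap ps ⟨
    length (map swap ps) ≤⟨ few (map swap ps) (AllPairs.map⁺ (AllPairs.map (_∘ cong swap) unique)) (All.map⁺ ps∈V) ⟩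
    5                    ∎
    where open ≤-Reasoning

  -- The cross argument.
  -- Throughout, U and W are sets of at most five grid points and F is the goal.

  module RowEscape {A B : Set} (_≟ᴬ_ : DecidableEquality A) (_≟ᴮ_ : DecidableEquality B)
    (U W : A → B → Set) (U? : ∀ x y → Dec (U x y)) (F : Set) (fewU : Few U)
    (crossU : ∀ {x y} → W x y → ¬ U x y → F ⊎ Cross U x y)
    (crossW : ∀ {x y} → U x y → ¬ W x y → F ⊎ Cross W x y) where

    -- A point (x', y₁) of W ∖ U off both axes
    -- of (x, y) forces a cross of U there; it supplies a point (x', ye) and a point
    -- (xe, y₁) of U off both axes, which together with the four arms of c are six.
    columnEscape : ∀ {x y} → ¬ U x y → (c : Cross U x y) →
                   ∀ {x' y₁} → x' ≢ x → y₁ ≢ y → W x' y₁ → ¬ U x' y₁ → F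
    columnEscape {x} {y} ¬u c x'≢x y₁≢y w₁ ¬u₁ with crossU w₁ ¬u₁
    ... | inj₁ f = f
    ... | inj₂ (row , col)
      with xe , ue₁ , xe≢x ← two-avoid _≟ᴬ_ row x | ye , ue₂ , ye≢y ← two-avoid _≟ᴮ_ col y =
      ⊥-elim (six-points fewU
        ((apartʸ (colApart U ue₂ ¬u₁) ∷ offAxis-fresh x'≢x ye≢y c) ∷ offAxis-fresh xe≢x y₁≢y c ∷ arms-unique ¬u c)
        (ue₂ ∷ ue₁ ∷ arms-∈ c) refl)

    -- If a row arm (x', y) of the cross c is missing from W, then W has a cross at
    -- (x', y); its two column points either both lie in U (six points of U) or one
    -- of them escapes U as in columnEscape.
    rowEscape : ∀ {x y} → ¬ U x y → (c : Cross U x y) → ∀ {x'} → U x' y → ¬ W x' y → F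
    rowEscape {x} {y} ¬u c {x'} u' ¬w' with crossW u' ¬w'
    ... | inj₁ f = f
    ... | inj₂ (_ , (y₁ , y₂ , y₁≢y₂ , w₁ , w₂)) with U? x' y₁ | U? x' y₂
    ... | no ¬u₁ | _ = columnEscape ¬u c (rowApart U u' ¬u) (colApart W w₁ ¬w') w₁ ¬u₁
    ... | _ | no ¬u₂ = columnEscape ¬u c (rowApart U u' ¬u) (colApart W w₂ ¬w') w₂ ¬u₂
    ... | yes u₁ | yes u₂ = ⊥-elim (six-points fewU
        ((apartʸ y₁≢y₂ ∷ offAxis-fresh x'≢x (colApart W w₁ ¬w') c)
         ∷ offAxis-fresh x'≢x (colApart W w₂ ¬w') c ∷ arms-unique ¬u c)
        (u₁ ∷ u₂ ∷ arms-∈ c) refl)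
      where
      x'≢x : x' ≢ x
      x'≢x = rowApart U u' ¬u

  module CrossArgument {A B : Set} (_≟ᴬ_ : DecidableEquality A) (_≟ᴮ_ : DecidableEquality B)
    (U W : A → B → Set) (U? : ∀ x y → Dec (U x y)) (W? : ∀ x y → Dec (W x y))
    (F : Set) (fewU : Few U) (fewW : Few W)
    (crossU : ∀ {x y} → W x y → ¬ U x y → F ⊎ Cross U x y)
    (crossW : ∀ {x y} → U x y → ¬ W x y → F ⊎ Cross W x y) where

    open RowEscape _≟ᴬ_ _≟ᴮ_ U W U? F fewU crossU crossW

    -- Column arms are row arms of the transposed grid.
    module Transposed = RowEscape _≟ᴮ_ _≟ᴬ_ (flip U) (flip W) (flip U?) F (Few-transpose fewU)
      (λ w ¬u → Sum.map₂ (transpose {V = U}) (crossU w ¬u)) (λ u ¬w → Sum.map₂ (transpose {V = W}) (crossW u ¬w))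

    offAxisPoint : ∀ {x y xq yq} → ¬ U x y → U xq yq → Cross W xq yq →
                   ∃₂ λ ex ey → ex ≢ x × ey ≢ y × W ex ey
    offAxisPoint {x} {y} {xq} {yq} ¬u uq (row , col) with yq ≟ᴮ y
    ... | yes refl with ey , wq , ey≢y ← two-avoid _≟ᴮ_ col y = xq , ey , rowApart U uq ¬u , ey≢y , wq
    ... | no yq≢y with ex , wq , ex≢x ← two-avoid _≟ᴬ_ row x = ex , yq , ex≢x , yq≢y , wq

    -- If W contains a point (x, y) ∉ U together with the whole cross of U there,
    -- then a point of U ∖ W gives W a sixth point.
    fullCross : ∀ {x y xq yq} → W x y → ¬ U x y → (c : Cross U x y) → All (uncurry W) (arms c) →
                U xq yq → ¬ W xq yq → F
    fullCross w ¬u c arms⊆W uq ¬wq with crossW uq ¬wq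
    ... | inj₁ f = f
    ... | inj₂ cq with ex , ey , ex≢x , ey≢y , we ← offAxisPoint ¬u uq cq =
      ⊥-elim (six-points fewW
        ((apartˣ ex≢x ∷ offAxis-fresh ex≢x ey≢y c) ∷ centre-fresh ¬u c ∷ arms-unique ¬u c)
        (we ∷ w ∷ arms⊆W) refl)

    resolve : ∀ {x y xq yq} → W x y → ¬ U x y → U xq yq → ¬ W xq yq → F
    resolve {x} {y} w ¬u uq ¬wq with crossU w ¬u
    ... | inj₁ f = f
    ... | inj₂ c@((xl , xr , _ , ul , ur) , (yd , yu , _ , ud , uu)) with W? xl y | W? xr y | W? x yd | W? x yu
    ... | no ¬wl | _      | _      | _      = rowEscape ¬u c ul ¬wl
    ... | _      | no ¬wr | _      | _      = rowEscape ¬u c ur ¬wr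
    ... | _      | _      | no ¬wd | _      = Transposed.rowEscape ¬u (transpose {V = U} c) ud ¬wd
    ... | _      | _      | _      | no ¬wu = Transposed.rowEscape ¬u (transpose {V = U} c) uu ¬wu
    ... | yes wl | yes wr | yes wd | yes wu = fullCross w ¬u c (wl ∷ wr ∷ wd ∷ wu ∷ []) uq ¬wq

  -- The torus C_a □ C_b with a, b ≥ 9: rows and columns are cycles on which the
  -- line lemmas apply, and the cross argument runs on the grid points of U and W.

  module Torus (a b : ℕ) .{{_ : NonZero a}} .{{_ : NonZero b}} (9≤a : 9 ≤ a) (9≤b : 9 ≤ b) where

    In : Subset (a * b) → Fin a → Fin b → Set
    In V x y = vtx x y ∈ V

    vtx-injective : ∀ {x x' y y'} → vtx {a} {b} x y ≡ vtx x' y' → x ≡ x' × y ≡ y'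
    vtx-injective = combine-injective _ _ _ _

    -- Lines in rows are the horizontal, lines in columns the vertical straight paths.
    module Row (y : Fin b) = Line 9≤a (λ x → vtx {a} {b} x y)
    module Column (x : Fin a) = Line 9≤b (λ y → vtx {a} {b} x y)

    straightPath-size : ∀ X → StraightPath5 a b X → ∣ X ∣ ≡ 5
    straightPath-size _ (i , j , inj₁ refl) = Row.line-size j (proj₁ ∘ vtx-injective) i
    straightPath-size _ (i , j , inj₂ refl) = Column.line-size i (proj₂ ∘ vtx-injective) j

    pathOrCross : ∀ V {x y} → ¬ In V x y →
      (∃ λ X → StraightPath5 a b X × vtx x y ∈ X × Disjoint V X) ⊎ Cross (In V) x y
    pathOrCross V {x} {y} ¬v with Row.scan y V x ¬v | Column.scan x V y ¬v
    ... | inj₁ (c₀ , z∈X , disjoint) | _ = inj₁ (hpath c₀ y , (c₀ , y , inj₁ refl) , z∈X , disjoint)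
    ... | _ | inj₁ (c₀ , z∈X , disjoint) = inj₁ (vpath x c₀ , (x , c₀ , inj₂ refl) , z∈X , disjoint)
    ... | inj₂ row | inj₂ col = inj₂ (row , col)

    few : ∀ V → ∣ V ∣ ≡ 5 → Few (In V)
    few V ∣V∣ ps unique ps∈V = begin
      length ps                     ≡⟨ length-map (uncurry vtx) ps ⟨
      length (map (uncurry vtx) ps) ≤⟨ unique⊆⇒length≤ V _ (AllPairs.map⁺ (AllPairs.map vtx-apart unique)) (All.map⁺ ps∈V) ⟩
      ∣ V ∣                         ≡⟨ ∣V∣ ⟩
      5                             ∎
      where
      open ≤-Reasoning
      vtx-apart : ∀ {p q : Fin a × Fin b} → p ≢ q → uncurry vtx p ≢ uncurry vtx q
      vtx-apart p≢q eq = p≢q (cong₂ _,_ (proj₁ (vtx-injective eq)) (proj₂ (vtx-injective eq)))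

    separatingPath : ∀ U W → ∣ U ∣ ≡ 5 → ∣ W ∣ ≡ 5 → U ≢ W → ∃ λ X → StraightPath5 a b X × Separates X U W
    separatingPath U W ∣U∣ ∣W∣ U≢W
      with p , p∈W , p∉U ← ∃-∈-∉ U W (trans ∣U∣ (sym ∣W∣)) U≢W
         | q , q∈U , q∉W ← ∃-∈-∉ W U (trans ∣W∣ (sym ∣U∣)) (U≢W ∘ sym)
      with _ , _ , refl ← combine-surjective {a} {b} p
         | _ , _ , refl ← combine-surjective {a} {b} q =
      CrossArgument.resolve _≟ᶠ_ _≟ᶠ_ (In U) (In W) (λ x y → vtx x y ∈? U) (λ x y → vtx x y ∈? W)
        Goal (few U ∣U∣) (few W ∣W∣) crossU crossW p∈W p∉U q∈U q∉W
      where
      Goal : Set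
      Goal = ∃ λ X → StraightPath5 a b X × Separates X U W
      crossU : ∀ {x y} → In W x y → ¬ In U x y → Goal ⊎ Cross (In U) x y
      crossU w ¬u = Sum.map₁ (λ (X , path , z∈X , U∩X=∅) → X , path , inj₁ (U∩X=∅ , (_ , x∈p∩q⁺ (w , z∈X))))
                             (pathOrCross U ¬u)
      crossW : ∀ {x y} → In U x y → ¬ In W x y → Goal ⊎ Cross (In W) x y
      crossW u ¬w = Sum.map₁ (λ (X , path , z∈X , W∩X=∅) → X , path , inj₂ (W∩X=∅ , (_ , x∈p∩q⁺ (u , z∈X))))
                             (pathOrCross W ¬w)

    straightPaths-resolve : IsResolving 5 (StraightPath5 a b)
    straightPaths-resolve = straightPath-size , λ U W ∣U∣ ∣W∣ U≢W →
      let X , path , separates = separatingPath U W ∣U∣ ∣W∣ U≢W in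
      X , path , separates⇒resolves 15≤ab ∣U∣ ∣W∣ (straightPath-size X path) separates
      where
      15≤ab : 3 * 5 ≤ a * b
      15≤ab = ≤-trans (m≤m+n 15 66) (*-mono-≤ 9≤a 9≤b)

open Resolving using (module Torus)
open import Data.List.Membership.Propositional using (_∈_)
open import Data.List.Membership.Propositional.Properties
  using (∈-cartesianProductWith⁺; ∈-cartesianProductWith⁻; ∈-allFin; ∈-++⁺ˡ; ∈-++⁺ʳ; ∈-++⁻)

length-cartesianProductWith : ∀ {A B C : Set} (f : A → B → C) (xs : List A) (ys : List B) →
  length (cartesianProductWith f xs ys) ≡ length xs * length ys
length-cartesianProductWith f []       ys = refl
length-cartesianProductWith f (x ∷ xs) ys = begin
  length (map (f x) ys ++ cartesianProductWith f xs ys)       ≡⟨ length-++ (map (f x) ys) ⟩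
  length (map (f x) ys) + length (cartesianProductWith f xs ys) ≡⟨ cong₂ _+_ (length-map (f x) ys) (length-cartesianProductWith f xs ys) ⟩
  length ys + length xs * length ys                           ∎
  where open ≡-Reasoning

module _ (a b : ℕ) .{{_ : NonZero a}} .{{_ : NonZero b}} where

  pathsAlong : (Fin a → Fin b → Subset (a * b)) → List (Subset (a * b))
  pathsAlong path = cartesianProductWith path (allFin a) (allFin b)

  straightPaths : List (Subset (a * b))
  straightPaths = pathsAlong hpath ++ pathsAlong vpath

  straightPaths-length : length straightPaths ≡ 2 * (a * b)
  straightPaths-length = begin
    length straightPaths                                  ≡⟨ length-++ (pathsAlong hpath) ⟩
    length (pathsAlong hpath) + length (pathsAlong vpath) ≡⟨ cong₂ _+_ (along-length hpath) (along-length vpath) ⟩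
    a * b + a * b                                         ≡⟨ cong (a * b +_) (+-identityʳ (a * b)) ⟨
    2 * (a * b)                                           ∎
    where
    open ≡-Reasoning
    along-length : ∀ path → length (pathsAlong path) ≡ a * b
    along-length path = trans (length-cartesianProductWith path (allFin a) (allFin b))
                              (cong₂ _*_ (length-tabulate {n = a} (λ i → i)) (length-tabulate {n = b} (λ j → j)))

  ∈-straightPaths : ∀ {X} → StraightPath5 a b X → X ∈ straightPaths
  ∈-straightPaths (i , j , inj₁ refl) = ∈-++⁺ˡ (∈-cartesianProductWith⁺ hpath (∈-allFin i) (∈-allFin j))
  ∈-straightPaths (i , j , inj₂ refl) = ∈-++⁺ʳ (pathsAlong hpath) (∈-cartesianProductWith⁺ vpath (∈-allFin i) (∈-allFin j))

  straightPaths-∈ : ∀ {X} → X ∈ straightPaths → StraightPath5 a b X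
  straightPaths-∈ X∈ with ∈-++⁻ (pathsAlong hpath) X∈
  ... | inj₁ X∈h with i , j , _ , _ , refl ← ∈-cartesianProductWith⁻ hpath (allFin a) (allFin b) X∈h = i , j , inj₁ refl
  ... | inj₂ X∈v with i , j , _ , _ , refl ← ∈-cartesianProductWith⁻ vpath (allFin a) (allFin b) X∈v = i , j , inj₂ refl

IsResolving-cong : ∀ {n k} {S T : Subset n → Set} → (∀ X → S X → T X) → (∀ X → T X → S X) →
                   IsResolving k S → IsResolving k T
IsResolving-cong S⇒T T⇒S (sizes , resolves) =
  (λ X → sizes X ∘ T⇒S X) ,
  λ U W ∣U∣ ∣W∣ U≢W → let X , X∈S , distances = resolves U W ∣U∣ ∣W∣ U≢W in X , S⇒T X X∈S , distances

-- The straight paths resolve K(ab, 5) (already for a, b ≥ 9); listing them gives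
-- a resolving set of size 2ab, so β(K(ab, 5)) ≤ 2ab.
theorem4p8 : (a b : ℕ) .{{_ : NonZero a}} .{{_ : NonZero b}} → 13 ≤ a → 13 ≤ b →
    IsResolving 5 (StraightPath5 a b)
    × (∃ λ (L : List (Subset (a * b))) → length L ≤ 2 * (a * b) × IsResolving 5 (λ X → X ∈ L))
theorem4p8 a b 13≤a 13≤b =
  resolving , straightPaths a b , ≤-reflexive (straightPaths-length a b) ,
  IsResolving-cong (λ _ → ∈-straightPaths a b) (λ _ → straightPaths-∈ a b) resolving
  where
  resolving : IsResolving 5 (StraightPath5 a b)
  resolving = Torus.straightPaths-resolve a b (≤-trans (m≤m+n 9 4) 13≤a) (≤-trans (m≤m+n 9 4) 13≤b)
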